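{- Let $T$ be a $\Delta(1,2,2)$-free tournament and let $\sigma$ be an ordering of $T$. Suppose three distinct vertices $a,b,c$ of $T$ satisfy: (i) $\{a,b,c\}$ induces a cyclic triangle in $T$; (ii) $a,b,c$ are consecutive in $\sigma$, appearing in this order; (iii) each of $a,b,c$ is paved in the ordered graph $B_\sigma(T)-ac$ (the backedge graph with the edge $ac$ deleted); (iv) no two distinct vertices of $\{a,b,c\}$ have a common neighbour in $B_\sigma(T)$. Then either $T$ contains $T_5$ or $P_7^-$, or there is an ordering $\sigma'$ of $T$ obtained from $\sigma$ by reordering $a,b,c$ such that $a,b,c$ are all paved in $B_{\sigma'}(T)$.
   Context: Tournaments are finite; $T$ contains $S$ if an induced subtournament is isomorphic to $S$, else is $S$-free. $X\Rightarrow Y$: all edges between disjoint $X,Y$ go from $X$ to $Y$. $\Delta(1,2,2)$: vertices $x,y_1,y_2,z_1,z_2$ with $x\Rightarrow\{y_1,y_2\}\Rightarrow\{z_1,z_2\}\Rightarrow x$ and edges $y_1y_2,z_1z_2$. $T_5$: vertices $v_1,\dots,v_5$, $v_iv_j\in E$ iff $j-i\equiv1,2\pmod5$. $P_7^-$: $P_7$ minus one vertex, where $P_7$ has vertices $v_1,\dots,v_7$ and $v_iv_j\in E$ iff $j-i\equiv1,2,4\pmod7$. For an ordering $\sigma=(v_1,\dots,v_n)$, $B_\sigma(T)$ is the undirected ordered graph on $V(T)$ with edges $v_iv_j$ for $i>j$ and $v_iv_j\in E(T)$. A vertex $v_i$ is paved in an ordered graph on this ordering if it has at most one neighbour in $\{v_s:s<i\}$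 and at most one in $\{v_t:t>i\}$. An ordering $\sigma'$ is obtained from $\sigma$ by reordering a set of vertices if $\sigma'$ agrees with $\sigma$ outside the positions of those vertices and permutes those vertices among their positions. -}

module Defs where

open import Data.Nat using (ℕ; zero; suc; _+_; _∸_; _<_; _%_)
open import Data.Fin using (Fin; toℕ; zero; suc)
open import Data.Bool using (Bool; true; false; T)
open import Data.Product using (Σ; _×_; _,_; ∃)
open import Data.Sum using (_⊎_)
open import Relation.Nullary using (¬_)
open import Relation.Binary.PropositionalEquality using (_≡_; _≢_)
open import Function.Definitions using (Injective)

-- A tournament on vertex set Fin n; E u v means the edge is directed u → v.
record Tournament (n : ℕ) : Set₁ where
  field
    E     : Fin n → Fin n → Set
    irrefl : ∀ v → ¬ E v v
    asym  : ∀ u v → E u v → ¬ E v u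
    total : ∀ u v → u ≢ v → E u v ⊎ E v u
open Tournament public

Contains : ∀ {n k} → Tournament n → (Fin k → Fin k → Set) → Set
Contains {n} {k} Tn S =
  Σ (Fin k → Fin n) λ f → Injective _≡_ _≡_ f ×
    (∀ i j → (S i j → E Tn (f i) (f j)) × (E Tn (f i) (f j) → S i j))

-- circulant tournaments on Z_m (vertex i ↦ i): i → j iff (j - i) mod m ∈ D
diffMod : ℕ → ℕ → ℕ → ℕ
diffMod m i j = (j + m ∸ i) % suc (m ∸ 1)

T5 : Fin 5 → Fin 5 → Set
T5 i j = diffMod 5 (toℕ i) (toℕ j) ≡ 1 ⊎ diffMod 5 (toℕ i) (toℕ j) ≡ 2

-- P_7 : v_i → v_j iff j - i ≡ 1,2,4 (mod 7); P_7^- : delete the last vertex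
-- (P_7 is vertex-transitive, so the choice of deleted vertex is immaterial).
P7 : Fin 7 → Fin 7 → Set
P7 i j = diffMod 7 (toℕ i) (toℕ j) ≡ 1 ⊎ (diffMod 7 (toℕ i) (toℕ j) ≡ 2 ⊎ diffMod 7 (toℕ i) (toℕ j) ≡ 4)

P7⁻ : Fin 6 → Fin 6 → Set
P7⁻ i j = P7 (Data.Fin.inject₁ i) (Data.Fin.inject₁ j)

-- Δ(1,2,2): 0 = x, 1 = y₁, 2 = y₂, 3 = z₁, 4 = z₂;
-- x ⇒ {y₁,y₂} ⇒ {z₁,z₂} ⇒ x, y₁ → y₂, z₁ → z₂.
Δ122b : Fin 5 → Fin 5 → Bool
Δ122b zero (suc zero) = true
Δ122b zero (suc (suc zero)) = true
Δ122b (suc zero) (suc (suc zero)) = true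
Δ122b (suc zero) (suc (suc (suc zero))) = true
Δ122b (suc zero) (suc (suc (suc (suc zero)))) = true
Δ122b (suc (suc zero)) (suc (suc (suc zero))) = true
Δ122b (suc (suc zero)) (suc (suc (suc (suc zero)))) = true
Δ122b (suc (suc (suc zero))) zero = true
Δ122b (suc (suc (suc zero))) (suc (suc (suc (suc zero)))) = true
Δ122b (suc (suc (suc (suc zero)))) zero = true
Δ122b _ _ = false

Δ122 : Fin 5 → Fin 5 → Set
Δ122 i j = T (Δ122b i j)

record Ordering (n : ℕ) : Set where
  field
    pos    : Fin n → Fin n
    posInj : Injective _≡_ _≡_ pos
open Ordering public

_before_ : ∀ {n} → Ordering n → Fin n → Fin n → Set
_before_ σ u w = toℕ (pos σ u) < toℕ (pos σ w)

B : ∀ {n} → Tournament n → Ordering n → Fin n → Fin n → Set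
B Tn σ u w = (_before_ σ w u × E Tn u w) ⊎ (_before_ σ u w × E Tn w u)

deleteEdge : ∀ {n} → (Fin n → Fin n → Set) → Fin n → Fin n → Fin n → Fin n → Set
deleteEdge G x y u w = G u w × ¬ ((u ≡ x × w ≡ y) ⊎ (u ≡ y × w ≡ x))

Paved : ∀ {n} → Ordering n → (Fin n → Fin n → Set) → Fin n → Set
Paved σ G v =
  (∀ x y → G v x → G v y → _before_ σ x v → _before_ σ y v → x ≡ y) ×
  (∀ x y → G v x → G v y → _before_ σ v x → _before_ σ v y → x ≡ y)

CyclicTriangle : ∀ {n} → Tournament n → Fin n → Fin n → Fin n → Set
CyclicTriangle Tn a b c =
  (E Tn a b × E Tn b c × E Tn c a) ⊎ (E Tn a c × E Tn c b × E Tn b a)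

Consecutive : ∀ {n} → Ordering n → Fin n → Fin n → Fin n → Set
Consecutive σ a b c =
  toℕ (pos σ b) ≡ suc (toℕ (pos σ a)) × toℕ (pos σ c) ≡ suc (toℕ (pos σ b))

NoCommonNbr : ∀ {n} → (Fin n → Fin n → Set) → Fin n → Fin n → Set
NoCommonNbr G u w = ∀ x → ¬ (G u x × G w x)

In3 : ∀ {A : Set} → A → A → A → A → Set
In3 a b c x = x ≡ a ⊎ (x ≡ b ⊎ x ≡ c)

ReorderOf : ∀ {n} → Ordering n → Ordering n → Fin n → Fin n → Fin n → Set
ReorderOf σ σ' a b c =
  (∀ v → ¬ In3 a b c v → pos σ' v ≡ pos σ v) ×
  (∀ v → In3 a b c v → In3 (pos σ a) (pos σ b) (pos σ c) (pos σ' v))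

module Submission where

-- The triangle cannot be oriented a → c → b → a, since b would then be a common neighbour
-- of a and c. So a → b → c → a, and the only backedge inside the block a b c of σ is ca;
-- rotating the block to b c a or c a b moves no other vertex and makes ab or bc the only
-- backedge instead. As no two of a, b, c have a common neighbour, an outside vertex x that
-- is a B_σ-neighbour of one of them meets the other two by forward edges. Hence the rotation
-- whose backedge is the arc w → u paves the block unless u has an outside neighbour after
-- the block or w one before it, and such a neighbour x satisfies w → x → u. If all three
-- rotations fail, every arc of the triangle is subdivided in this way, and each of the 64
-- tournaments on the six resulting vertices contains Δ(1,2,2) or P₇⁻ (checked by computation).

open import Defs
open import Data.Nat as ℕ using (ℕ; suc; _<_; _≤_)
open import Data.Nat.Properties using (_<?_; <-asym; ≤-trans; ≤-<-trans; <-≤-trans; ≤-refl; n≤1+n; n<1+n; ≤∧≢⇒<; ≮⇒≥)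
open import Data.Fin using (Fin; zero; suc; toℕ; inject₁; _≟_)
open import Data.Fin.Patterns using (0F; 1F; 2F; 3F; 4F; 5F)
open import Data.Fin.Properties using (all?; any?; toℕ-injective)
open import Data.Fin.Permutation using (Permutation; _⟨$⟩ʳ_; _∘ₚ_; transpose)
import Data.Fin.Permutation.Components as PC
open import Data.Bool.Properties using (T?)
open import Data.Empty using (⊥; ⊥-elim)
open import Data.Product using (Σ; ∃; _×_; _,_; proj₁; proj₂; swap)
open import Data.Product.Properties using (≡-dec)
open import Data.Sum using (_⊎_; inj₁; inj₂; [_,_]′)
open import Data.List using (List; []; _∷_; _++_; map; concatMap; filter; allFin)
open import Data.List.Membership.Propositional using (_∈_)
open import Data.List.Membership.Propositional.Properties using (∈-++⁺ˡ; ∈-++⁺ʳ)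
import Data.List.Membership.DecPropositional as ListMembership
open import Data.List.Relation.Unary.All as All using (All; []; _∷_)
open import Data.List.Relation.Unary.Any as Any using (Any; here)
open import Data.Vec using (Vec; lookup) renaming ([] to []ᵥ; _∷_ to _∷ᵥ_)
open import Function using (_∘_; Injection)
open import Function.Properties.Inverse using (↔⇒↣)
open import Function.Definitions using (Injective)
open import Relation.Binary using (Decidable)
open import Relation.Binary.PropositionalEquality using (_≡_; _≢_; refl; sym; trans; cong; subst; ≢-sym)
open import Relation.Nullary using (¬_; Dec; yes; no; ¬?)
open import Relation.Nullary.Decidable using (from-yes; _×-dec_; _⊎-dec_; _→-dec_; dec-true; dec-false)
import Relation.Unary as U

Semicomplete : ∀ {k} → (Fin k → Fin k → Set) → Set
Semicomplete R = ∀ i j → i ≢ j → R i j ⊎ R j i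

semicomplete? : ∀ {k} {R : Fin k → Fin k → Set} → Decidable R → Dec (Semicomplete R)
semicomplete? R? = all? λ i → all? λ j → ¬? (i ≟ j) →-dec (R? i j ⊎-dec R? j i)

edge? : ∀ {n} (T : Tournament n) → Decidable (E T)
edge? T u v with u ≟ v
... | yes refl = no (irrefl T u)
... | no u≢v with total T u v u≢v
... | inj₁ euv = yes euv
... | inj₂ evu = no (asym T v u evu)

path-ends-distinct : ∀ {n} (T : Tournament n) {u p v} → E T u p → E T p v → u ≢ v
path-ends-distinct T eup epv refl = asym T _ _ eup epv

Hom : ∀ {A B : Set} → (A → A → Set) → (B → B → Set) → (A → B) → Set
Hom R S f = ∀ i j → R i j → S (f i) (f j)

hom⇒contains : ∀ {n k} (T : Tournament n) {R : Fin k → Fin k → Set} → Semicomplete R →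
  (f : Fin k → Fin n) → Hom R (E T) f → Contains T R
hom⇒contains T {R} semi f hom = f , injective , λ i j → hom i j , reflects i j
  where
  reflects : ∀ i j → E T (f i) (f j) → R i j
  reflects i j e with i ≟ j
  ... | yes refl = ⊥-elim (irrefl T (f i) e)
  ... | no i≢j with semi i j i≢j
  ... | inj₁ r = r
  ... | inj₂ r = ⊥-elim (asym T _ _ e (hom j i r))
  injective : Injective _≡_ _≡_ f
  injective {i} {j} fi≡fj with i ≟ j
  ... | yes i≡j = i≡j
  ... | no i≢j with semi i j i≢j
  ... | inj₁ r = ⊥-elim (irrefl T (f j) (subst (λ u → E T u (f j)) fi≡fj (hom i j r)))
  ... | inj₂ r = ⊥-elim (irrefl T (f j) (subst (E T (f j)) fi≡fj (hom j i r)))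

composite⇒contains : ∀ {n k m} (T : Tournament n) {R : Fin k → Fin k → Set} {S : Fin m → Fin m → Set} →
  Semicomplete R → (f : Fin m → Fin n) → Hom S (E T) f → ∃ (Hom R S ∘ lookup) → Contains T R
composite⇒contains T semi f f-hom (g , g-hom) =
  hom⇒contains T semi (f ∘ lookup g) λ i j → f-hom (lookup g i) (lookup g j) ∘ g-hom i j

-- Finding homomorphisms by computation

hom? : ∀ {k m} {R : Fin k → Fin k → Set} {S : Fin m → Fin m → Set} →
  Decidable R → Decidable S → ∀ f → Dec (Hom R S f)
hom? R? S? f = all? λ i → all? λ j → R? i j →-dec S? (f i) (f j)

-- Backtracking: vertex 0 is mapped last, to a vertex compatible with the images of the
-- others.
homCandidates : ∀ {k m} {R : Fin k → Fin k → Set} {S : Fin m → Fin m → Set} →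
  Decidable R → Decidable S → List (Vec (Fin m) k)
homCandidates {ℕ.zero} R? S? = []ᵥ ∷ []
homCandidates {suc k} {m} {R} {S} R? S? = concatMap extend (homCandidates (λ i j → R? (suc i) (suc j)) S?)
  where
  fits? : (t : Vec (Fin m) k) (v : Fin m) →
    Dec (∀ j → (R zero (suc j) → S v (lookup t j)) × (R (suc j) zero → S (lookup t j) v))
  fits? t v = all? λ j → (R? zero (suc j) →-dec S? v (lookup t j)) ×-dec (R? (suc j) zero →-dec S? (lookup t j) v)
  extend : Vec (Fin m) k → List (Vec (Fin m) (suc k))
  extend t = map (_∷ᵥ t) (filter (fits? t) (allFin m))

HasHom : ∀ {k m} {R : Fin k → Fin k → Set} {S : Fin m → Fin m → Set} → Decidable R → Decidable S → Set
HasHom {R = R} {S} R? S? = Any (Hom R S ∘ lookup) (homCandidates R? S?)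

hasHom? : ∀ {k m} {R : Fin k → Fin k → Set} {S : Fin m → Fin m → Set} →
  (R? : Decidable R) (S? : Decidable S) → Dec (HasHom R? S?)
hasHom? R? S? = Any.any? (hom? R? S? ∘ lookup) _

Arc : ∀ {A : Set} → List (A × A) → A → A → Set
Arc arcs i j = (i , j) ∈ arcs

arc? : ∀ {k} (arcs : List (Fin k × Fin k)) → Decidable (Arc arcs)
arc? arcs i j = (i , j) ∈? arcs
  where open ListMembership (≡-dec _≟_ _≟_) using (_∈?_)

arcs-hom : ∀ {A B : Set} {R : B → B → Set} {arcs : List (A × A)} (f : A → B) →
  All (λ (i , j) → R (f i) (f j)) arcs → Hom (Arc arcs) R f
arcs-hom f holds i j = All.lookup holds

orientations : ∀ {A : Set} → List (A × A) → List (A × A) → List (List (A × A))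
orientations arcs [] = arcs ∷ []
orientations arcs (p ∷ ps) = orientations (p ∷ arcs) ps ++ orientations (swap p ∷ arcs) ps

orientation-∈ : ∀ {A : Set} {P : A × A → Set} {arcs : List (A × A)} ps → All P arcs →
  All (λ p → P p ⊎ P (swap p)) ps → ∃ λ os → os ∈ orientations arcs ps × All P os
orientation-∈ [] holds [] = _ , here refl , holds
orientation-∈ (p ∷ ps) holds (inj₁ q ∷ qs) with orientation-∈ ps (q ∷ holds) qs
... | os , os∈ , os-holds = os , ∈-++⁺ˡ os∈ , os-holds
orientation-∈ {arcs = arcs} (p ∷ ps) holds (inj₂ q ∷ qs) with orientation-∈ ps (q ∷ holds) qs
... | os , os∈ , os-holds = os , ∈-++⁺ʳ (orientations (p ∷ arcs) ps) os∈ , os-holds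

Δ122? : Decidable Δ122
Δ122? i j = T? (Δ122b i j)

P7⁻? : Decidable P7⁻
P7⁻? i j = (d ℕ.≟ 1) ⊎-dec ((d ℕ.≟ 2) ⊎-dec (d ℕ.≟ 4))
  where
  d : ℕ
  d = diffMod 7 (toℕ (inject₁ i)) (toℕ (inject₁ j))

-- Vertices 0, 1, 2 are the cyclic triangle a → b → c → a, and 3, 4, 5 subdivide
-- its arcs c → a, a → b and b → c; freePairs are the six remaining pairs.
subdividedTriangle freePairs : List (Fin 6 × Fin 6)
subdividedTriangle =
  (0F , 1F) ∷ (1F , 2F) ∷ (2F , 0F) ∷ (2F , 3F) ∷ (3F , 0F) ∷ (0F , 4F) ∷ (4F , 1F) ∷ (1F , 5F) ∷ (5F , 2F) ∷ []
freePairs = (3F , 1F) ∷ (4F , 2F) ∷ (5F , 0F) ∷ (3F , 4F) ∷ (3F , 5F) ∷ (4F , 5F) ∷ []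

subdivided-triangle-patterns : All (λ arcs → HasHom Δ122? (arc? arcs) ⊎ HasHom P7⁻? (arc? arcs))
  (orientations subdividedTriangle freePairs)
subdivided-triangle-patterns = from-yes
  (All.all? (λ arcs → hasHom? Δ122? (arc? arcs) ⊎-dec hasHom? P7⁻? (arc? arcs))
    (orientations subdividedTriangle freePairs))

subdivided-triangle : ∀ {n} (T : Tournament n) {a b c x y z} →
  E T a b → E T b c → E T c a → E T c x → E T x a → E T a y → E T y b → E T b z → E T z c →
  Contains T Δ122 ⊎ Contains T P7⁻
subdivided-triangle {n} T {a} {b} {c} {x} {y} {z} eab ebc eca ecx exa eay eyb ebz ezc =
  embed (orientation-∈ freePairs (eab ∷ ebc ∷ eca ∷ ecx ∷ exa ∷ eay ∷ eyb ∷ ebz ∷ ezc ∷ []) free)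
  where
  f : Fin 6 → Fin n
  f = lookup (a ∷ᵥ b ∷ᵥ c ∷ᵥ x ∷ᵥ y ∷ᵥ z ∷ᵥ []ᵥ)
  Edge : Fin 6 × Fin 6 → Set
  Edge (i , j) = E T (f i) (f j)
  free : All (λ p → Edge p ⊎ Edge (swap p)) freePairs
  free = total T x b (≢-sym (path-ends-distinct T ebc ecx))
       ∷ total T y c (≢-sym (path-ends-distinct T eca eay))
       ∷ total T z a (≢-sym (path-ends-distinct T eab ebz))
       ∷ total T x y (path-ends-distinct T exa eay)
       ∷ total T x z (≢-sym (path-ends-distinct T ezc ecx))
       ∷ total T y z (path-ends-distinct T eyb ebz) ∷ []
  embed : ∃ (λ arcs → arcs ∈ orientations subdividedTriangle freePairs × All Edge arcs) →
    Contains T Δ122 ⊎ Contains T P7⁻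
  embed (arcs , arcs∈ , holds) =
    [ inj₁ ∘ composite⇒contains T (from-yes (semicomplete? Δ122?)) f (arcs-hom {R = E T} f holds) ∘ Any.satisfied
    , inj₂ ∘ composite⇒contains T (from-yes (semicomplete? P7⁻?)) f (arcs-hom {R = E T} f holds) ∘ Any.satisfied
    ]′ (All.lookup subdivided-triangle-patterns arcs∈)

In3-map : ∀ {A B : Set} (f : A → B) {a b c x} → In3 a b c x → In3 (f a) (f b) (f c) (f x)
In3-map f (inj₁ refl) = inj₁ refl
In3-map f (inj₂ (inj₁ refl)) = inj₂ (inj₁ refl)
In3-map f (inj₂ (inj₂ refl)) = inj₂ (inj₂ refl)

In3-rotate : ∀ {A : Set} {a b c x : A} → In3 a b c x → In3 b c a x
In3-rotate (inj₁ x≡a) = inj₂ (inj₂ x≡a)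
In3-rotate (inj₂ (inj₁ x≡b)) = inj₁ x≡b
In3-rotate (inj₂ (inj₂ x≡c)) = inj₂ (inj₁ x≡c)

Window : ℕ → ℕ → Set
Window q = In3 q (suc q) (suc (suc q))

window-bounds : ∀ {q r} → Window q r → q ≤ r × r ≤ suc (suc q)
window-bounds {q} (inj₁ refl) = ≤-refl , ≤-trans (n≤1+n q) (n≤1+n (suc q))
window-bounds {q} (inj₂ (inj₁ refl)) = n≤1+n q , n≤1+n (suc q)
window-bounds {q} (inj₂ (inj₂ refl)) = ≤-trans (n≤1+n q) (n≤1+n (suc q)) , ≤-refl

outside-window : ∀ {q r} → ¬ Window q r →
  (∀ {r′} → Window q r′ → r < r′) ⊎ (∀ {r′} → Window q r′ → r′ < r)
outside-window {q} {r} r∉ with r <? q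
... | yes r<q = inj₁ λ r′∈ → <-≤-trans r<q (proj₁ (window-bounds r′∈))
... | no r≮q = inj₂ λ r′∈ → ≤-<-trans (proj₂ (window-bounds r′∈)) q+2<r
  where
  q+2<r : suc (suc q) < r
  q+2<r = ≤∧≢⇒< (≤∧≢⇒< (≤∧≢⇒< (≮⇒≥ r≮q) (r∉ ∘ inj₁ ∘ sym)) (r∉ ∘ inj₂ ∘ inj₁ ∘ sym)) (r∉ ∘ inj₂ ∘ inj₂ ∘ sym)

AtMostOne : ∀ {A : Set} → (A → Set) → Set
AtMostOne P = ∀ {x y} → P x → P y → x ≡ y

atMostOne-split : ∀ {A : Set} {P Q : A → Set} → U.Decidable Q →
  AtMostOne (λ x → P x × Q x) → AtMostOne (λ x → P x × ¬ Q x) →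
  (∀ {x y} → P x → Q x → P y → ¬ Q y → ⊥) → AtMostOne P
atMostOne-split Q? in-Q out-Q mixed {x} {y} px py with Q? x | Q? y
... | yes qx | yes qy = in-Q (px , qx) (py , qy)
... | yes qx | no ¬qy = ⊥-elim (mixed px qx py ¬qy)
... | no ¬qx | yes qy = ⊥-elim (mixed py qy px ¬qx)
... | no ¬qx | no ¬qy = out-Q (px , ¬qx) (py , ¬qy)

module _ {n : ℕ} (T : Tournament n) (τ : Ordering n) where

  LeftNbr RightNbr : Fin n → Fin n → Set
  LeftNbr v x = E T v x × _before_ τ x v
  RightNbr v x = E T x v × _before_ τ v x

  paved-B : ∀ {v} → AtMostOne (LeftNbr v) → AtMostOne (RightNbr v) → Paved τ (B T τ) v
  paved-B {v} left right =
    (λ x y bx by x<v y<v → left (back-left bx x<v , x<v) (back-left by y<v , y<v)) ,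
    (λ x y bx by v<x v<y → right (back-right bx v<x , v<x) (back-right by v<y , v<y))
    where
    back-left : ∀ {x} → B T τ v x → _before_ τ x v → E T v x
    back-left (inj₁ (_ , evx)) _ = evx
    back-left (inj₂ (v<x , _)) x<v = ⊥-elim (<-asym v<x x<v)
    back-right : ∀ {x} → B T τ v x → _before_ τ v x → E T x v
    back-right (inj₁ (x<v , _)) v<x = ⊥-elim (<-asym v<x x<v)
    back-right (inj₂ (_ , exv)) _ = exv

  ¬B⇒forwardˡ : ∀ {u x} → _before_ τ u x → u ≢ x → ¬ B T τ u x → E T u x
  ¬B⇒forwardˡ {u} {x} u<x u≢x ¬b with total T u x u≢x
  ... | inj₁ eux = eux
  ... | inj₂ exu = ⊥-elim (¬b (inj₂ (u<x , exu)))

  ¬B⇒forwardʳ : ∀ {u x} → _before_ τ x u → u ≢ x → ¬ B T τ u x → E T x u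
  ¬B⇒forwardʳ {u} {x} x<u u≢x ¬b with total T u x u≢x
  ... | inj₁ eux = ⊥-elim (¬b (inj₁ (x<u , eux)))
  ... | inj₂ exu = exu

successor-before : ∀ {n} (τ : Ordering n) {x y} → toℕ (pos τ y) ≡ suc (toℕ (pos τ x)) → _before_ τ x y
successor-before τ {x} y≡1+x = subst (toℕ (pos τ x) <_) (sym y≡1+x) (n<1+n (toℕ (pos τ x)))

consecutive-cong : ∀ {n} {σ : Ordering n} {u v w u′ v′ w′} → u ≡ u′ → v ≡ v′ → w ≡ w′ →
  Consecutive σ u v w → Consecutive σ u′ v′ w′
consecutive-cong refl refl refl cons = cons

relabel : ∀ {n} → Ordering n → Permutation n n → Ordering n
relabel σ π = record { pos = pos σ ∘ (π ⟨$⟩ʳ_) ; posInj = λ eq → Injection.injective (↔⇒↣ π) (posInj σ eq) }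

module _ {n : ℕ} where

  transpose-matchˡ : ∀ (i j : Fin n) → PC.transpose i j i ≡ j
  transpose-matchˡ i j rewrite dec-true (i ≟ i) refl = refl

  transpose-matchʳ : ∀ (i j : Fin n) → PC.transpose i j j ≡ i
  transpose-matchʳ i j with j ≟ i
  ... | yes refl = refl
  ... | no _ rewrite dec-true (j ≟ j) refl = refl

  transpose-fix : ∀ {i j k : Fin n} → k ≢ i → k ≢ j → PC.transpose i j k ≡ k
  transpose-fix {i} {j} {k} k≢i k≢j rewrite dec-false (k ≟ i) k≢i | dec-false (k ≟ j) k≢j = refl

  cycle : Fin n → Fin n → Fin n → Permutation n n
  cycle u v w = transpose u v ∘ₚ transpose u w

  module Cycle {u v w : Fin n} (u≢v : u ≢ v) (v≢w : v ≢ w) (u≢w : u ≢ w) where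

    cycle-u : cycle u v w ⟨$⟩ʳ u ≡ v
    cycle-u = trans (cong (PC.transpose u w) (transpose-matchˡ u v)) (transpose-fix (≢-sym u≢v) v≢w)

    cycle-v : cycle u v w ⟨$⟩ʳ v ≡ w
    cycle-v = trans (cong (PC.transpose u w) (transpose-matchʳ u v)) (transpose-matchˡ u w)

    cycle-w : cycle u v w ⟨$⟩ʳ w ≡ u
    cycle-w = trans (cong (PC.transpose u w) (transpose-fix (≢-sym u≢w) (≢-sym v≢w))) (transpose-matchʳ u w)

    cycle-fix : ∀ {x} → ¬ In3 u v w x → cycle u v w ⟨$⟩ʳ x ≡ x
    cycle-fix x∉ = trans (cong (PC.transpose u w) (transpose-fix (x∉ ∘ inj₁) (x∉ ∘ inj₂ ∘ inj₁)))
                         (transpose-fix (x∉ ∘ inj₁) (x∉ ∘ inj₂ ∘ inj₂))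

    cycle-In3 : ∀ {x} → In3 u v w x → In3 u v w (cycle u v w ⟨$⟩ʳ x)
    cycle-In3 (inj₁ refl) = inj₂ (inj₁ cycle-u)
    cycle-In3 (inj₂ (inj₁ refl)) = inj₂ (inj₂ cycle-v)
    cycle-In3 (inj₂ (inj₂ refl)) = inj₁ cycle-w

-- Reordering a block of three consecutive vertices

module Block {n : ℕ} (T : Tournament n) (σ : Ordering n) {a b c : Fin n} (cons : Consecutive σ a b c) where

  Inside Outside : Fin n → Set
  Inside = In3 a b c
  Outside x = ¬ Inside x

  inside? : U.Decidable Inside
  inside? x = (x ≟ a) ⊎-dec ((x ≟ b) ⊎-dec (x ≟ c))

  a∈ : Inside a
  a∈ = inj₁ refl
  b∈ : Inside b
  b∈ = inj₂ (inj₁ refl)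
  c∈ : Inside c
  c∈ = inj₂ (inj₂ refl)

  inside≢outside : ∀ {s x} → Inside s → Outside x → s ≢ x
  inside≢outside s∈ x∉ s≡x = x∉ (subst Inside s≡x s∈)

  OutLeft OutRight : Fin n → Fin n → Set
  OutLeft s x = LeftNbr T σ s x × Outside x
  OutRight s x = RightNbr T σ s x × Outside x

  outside-paved : ∀ {s} → Paved σ (deleteEdge (B T σ) a c) s → AtMostOne (OutLeft s) × AtMostOne (OutRight s)
  outside-paved (left , right) =
    (λ ((esx , x<s) , x∉) ((esy , y<s) , y∉) → left _ _ (inj₁ (x<s , esx) , kept x∉) (inj₁ (y<s , esy) , kept y∉) x<s y<s) ,
    (λ ((exs , s<x) , x∉) ((eys , s<y) , y∉) → right _ _ (inj₂ (s<x , exs) , kept x∉) (inj₂ (s<y , eys) , kept y∉) s<x s<y)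
    where
    kept : ∀ {s x} → Outside x → ¬ ((s ≡ a × x ≡ c) ⊎ (s ≡ c × x ≡ a))
    kept x∉ (inj₁ (_ , x≡c)) = x∉ (inj₂ (inj₂ x≡c))
    kept x∉ (inj₂ (_ , x≡a)) = x∉ (inj₁ x≡a)

  start : ℕ
  start = toℕ (pos σ a)

  b≡1+a : toℕ (pos σ b) ≡ suc start
  b≡1+a = proj₁ cons

  c≡2+a : toℕ (pos σ c) ≡ suc (suc start)
  c≡2+a = trans (proj₂ cons) (cong suc b≡1+a)

  reorder-refl : ReorderOf σ σ a b c
  reorder-refl = (λ _ _ → refl) , λ _ → In3-map (pos σ)

  relabel-reorders : ∀ (π : Permutation n n) → (∀ {x} → Outside x → π ⟨$⟩ʳ x ≡ x) →
    (∀ {x} → Inside x → Inside (π ⟨$⟩ʳ x)) → ReorderOf σ (relabel σ π) a b c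
  relabel-reorders π fix keep = (λ x x∉ → cong (pos σ) (fix x∉)) , λ x x∈ → In3-map (pos σ) (keep x∈)

  insider-window : ∀ {τ s} → ReorderOf σ τ a b c → Inside s → Window start (toℕ (pos τ s))
  insider-window (_ , keep) s∈ with keep _ s∈
  ... | inj₁ e = inj₁ (cong toℕ e)
  ... | inj₂ (inj₁ e) = inj₂ (inj₁ (trans (cong toℕ e) b≡1+a))
  ... | inj₂ (inj₂ e) = inj₂ (inj₂ (trans (cong toℕ e) c≡2+a))

  outsider-window : ∀ {y} → Outside y → ¬ Window start (toℕ (pos σ y))
  outsider-window y∉ (inj₁ y≡a) = y∉ (inj₁ (posInj σ (toℕ-injective y≡a)))
  outsider-window y∉ (inj₂ (inj₁ y≡b)) = y∉ (inj₂ (inj₁ (posInj σ (toℕ-injective (trans y≡b (sym b≡1+a))))))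
  outsider-window y∉ (inj₂ (inj₂ y≡c)) = y∉ (inj₂ (inj₂ (posInj σ (toℕ-injective (trans y≡c (sym c≡2+a))))))

  outsider-side : ∀ {y} → Outside y →
    (∀ {τ s} → ReorderOf σ τ a b c → Inside s → _before_ τ y s) ⊎
    (∀ {τ s} → ReorderOf σ τ a b c → Inside s → _before_ τ s y)
  outsider-side {y} y∉ with outside-window (outsider-window y∉)
  ... | inj₁ below = inj₁ λ {τ} {s} reord s∈ →
    subst (_< toℕ (pos τ s)) (sym (cong toℕ (proj₁ reord y y∉))) (below (insider-window {τ} {s} reord s∈))
  ... | inj₂ above = inj₂ λ {τ} {s} reord s∈ →
    subst (toℕ (pos τ s) <_) (sym (cong toℕ (proj₁ reord y y∉))) (above (insider-window {τ} {s} reord s∈))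

  outsider-side-invariant : ∀ {τ τ′ y s s′} → ReorderOf σ τ a b c → ReorderOf σ τ′ a b c →
    Outside y → Inside s → Inside s′ → (_before_ τ y s → _before_ τ′ y s′) × (_before_ τ s y → _before_ τ′ s′ y)
  outsider-side-invariant {τ} {τ′} {y} {s} {s′} reord reord′ y∉ s∈ s′∈ with outsider-side y∉
  ... | inj₁ below = (λ _ → below {τ′} {s′} reord′ s′∈) , (λ s<y → ⊥-elim (<-asym s<y (below {τ} {s} reord s∈)))
  ... | inj₂ above = (λ y<s → ⊥-elim (<-asym y<s (above {τ} {s} reord s∈))) , (λ _ → above {τ′} {s′} reord′ s′∈)

  outLeft? : ∀ s → U.Decidable (OutLeft s)
  outLeft? s x = (edge? T s x ×-dec (toℕ (pos σ x) <? toℕ (pos σ s))) ×-dec ¬? (inside? x)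

  outRight? : ∀ s → U.Decidable (OutRight s)
  outRight? s x = (edge? T x s ×-dec (toℕ (pos σ s) <? toℕ (pos σ x))) ×-dec ¬? (inside? x)

  arc-clear-or-subdivided : ∀ {t h} → Inside t → Inside h → NoCommonNbr (B T σ) t h →
    (¬ ∃ (OutLeft t) × ¬ ∃ (OutRight h)) ⊎ ∃ λ x → E T t x × E T x h
  arc-clear-or-subdivided {t} {h} t∈ h∈ no-common with any? (outRight? h) | any? (outLeft? t)
  ... | yes (x , (exh , h<x) , x∉) | _ =
    inj₂ (x , ¬B⇒forwardˡ T σ t<x (inside≢outside t∈ x∉) (λ btx → no-common x (btx , inj₂ (h<x , exh))) , exh)
    where
    t<x : _before_ σ t x
    t<x = proj₂ (outsider-side-invariant {σ} {σ} {x} {h} {t} reorder-refl reorder-refl x∉ h∈ t∈) h<x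
  ... | no _ | yes (x , (etx , x<t) , x∉) =
    inj₂ (x , etx , ¬B⇒forwardʳ T σ x<h (inside≢outside h∈ x∉) (λ bhx → no-common x (inj₁ (x<t , etx) , bhx)))
    where
    x<h : _before_ σ x h
    x<h = proj₁ (outsider-side-invariant {σ} {σ} {x} {t} {h} reorder-refl reorder-refl x∉ t∈ h∈) x<t
  ... | no no-right | no no-left = inj₁ (no-left , no-right)

  module Rotation (τ : Ordering n) (reord : ReorderOf σ τ a b c) {u v w : Fin n}
    (cover : ∀ {s} → Inside s → In3 u v w s) (euv : E T u v) (evw : E T v w) (ewu : E T w u)
    (consτ : Consecutive τ u v w) where

    back-arc : ∀ {s x} → In3 u v w s → In3 u v w x → E T s x → _before_ τ x s → s ≡ w × x ≡ u
    back-arc (inj₁ refl) (inj₁ refl) e _ = ⊥-elim (irrefl T _ e)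
    back-arc (inj₁ refl) (inj₂ (inj₁ refl)) _ v<u = ⊥-elim (<-asym v<u (successor-before τ (proj₁ consτ)))
    back-arc (inj₁ refl) (inj₂ (inj₂ refl)) e _ = ⊥-elim (asym T _ _ e ewu)
    back-arc (inj₂ (inj₁ refl)) (inj₁ refl) e _ = ⊥-elim (asym T _ _ e euv)
    back-arc (inj₂ (inj₁ refl)) (inj₂ (inj₁ refl)) e _ = ⊥-elim (irrefl T _ e)
    back-arc (inj₂ (inj₁ refl)) (inj₂ (inj₂ refl)) _ w<v = ⊥-elim (<-asym w<v (successor-before τ (proj₂ consτ)))
    back-arc (inj₂ (inj₂ refl)) (inj₁ refl) _ _ = refl , refl
    back-arc (inj₂ (inj₂ refl)) (inj₂ (inj₁ refl)) e _ = ⊥-elim (asym T _ _ e evw)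
    back-arc (inj₂ (inj₂ refl)) (inj₂ (inj₂ refl)) e _ = ⊥-elim (irrefl T _ e)

    rotation-paved : (∀ {s} → Inside s → AtMostOne (OutLeft s) × AtMostOne (OutRight s)) →
      ¬ ∃ (OutRight u) → ¬ ∃ (OutLeft w) → ∀ {s} → Inside s → Paved τ (B T τ) s
    rotation-paved out-paved u-clear w-clear {s} s∈ = paved-B T τ left right
      where
      out-left : ∀ {x} → LeftNbr T τ s x → Outside x → OutLeft s x
      out-left {x} (esx , x<s) x∉ =
        (esx , proj₁ (outsider-side-invariant {τ} {σ} {x} {s} {s} reord reorder-refl x∉ s∈ s∈) x<s) , x∉
      out-right : ∀ {x} → RightNbr T τ s x → Outside x → OutRight s x
      out-right {x} (exs , s<x) x∉ =
        (exs , proj₂ (outsider-side-invariant {τ} {σ} {x} {s} {s} reord reorder-refl x∉ s∈ s∈) s<x) , x∉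
      left : AtMostOne (LeftNbr T τ s)
      left = atMostOne-split inside?
        (λ ((esx , x<s) , x∈) ((esy , y<s) , y∈) →
          trans (proj₂ (back-arc (cover s∈) (cover x∈) esx x<s)) (sym (proj₂ (back-arc (cover s∈) (cover y∈) esy y<s))))
        (λ (ℓx , x∉) (ℓy , y∉) → proj₁ (out-paved s∈) (out-left ℓx x∉) (out-left ℓy y∉))
        (λ {x} {y} (esx , x<s) x∈ ℓy y∉ →
          w-clear (y , subst (λ t → OutLeft t y) (proj₁ (back-arc (cover s∈) (cover x∈) esx x<s)) (out-left ℓy y∉)))
      right : AtMostOne (RightNbr T τ s)
      right = atMostOne-split inside?
        (λ ((exs , s<x) , x∈) ((eys , s<y) , y∈) →
          trans (proj₁ (back-arc (cover x∈) (cover s∈) exs s<x)) (sym (proj₁ (back-arc (cover y∈) (cover s∈) eys s<y))))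
        (λ (rx , x∉) (ry , y∉) → proj₂ (out-paved s∈) (out-right rx x∉) (out-right ry y∉))
        (λ {x} {y} (exs , s<x) x∈ ry y∉ →
          u-clear (y , subst (λ t → OutRight t y) (proj₂ (back-arc (cover x∈) (cover s∈) exs s<x)) (out-right ry y∉)))

  module Rotations (a≢b : a ≢ b) (b≢c : b ≢ c) (a≢c : a ≢ c)
    (eab : E T a b) (ebc : E T b c) (eca : E T c a)
    (out-paved : ∀ {s} → Inside s → AtMostOne (OutLeft s) × AtMostOne (OutRight s)) where

    open Cycle a≢b b≢c a≢c

    Repaved : Set
    Repaved = Σ (Ordering n) λ τ → ReorderOf σ τ a b c ×
      (Paved τ (B T τ) a × Paved τ (B T τ) b × Paved τ (B T τ) c)

    repaved : ∀ τ → ReorderOf σ τ a b c → (∀ {s} → Inside s → Paved τ (B T τ) s) → Repaved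
    repaved τ reord paved = τ , reord , paved a∈ , paved b∈ , paved c∈

    ρ ρ² : Permutation n n
    ρ = cycle a b c
    ρ² = ρ ∘ₚ ρ

    rotate-abc : ¬ ∃ (OutLeft c) × ¬ ∃ (OutRight a) → Repaved
    rotate-abc (c-clear , a-clear) = repaved σ reorder-refl
      (Rotation.rotation-paved σ reorder-refl (λ s∈ → s∈) eab ebc eca cons out-paved a-clear c-clear)

    rotate-cab : ¬ ∃ (OutLeft b) × ¬ ∃ (OutRight c) → Repaved
    rotate-cab (b-clear , c-clear) = repaved (relabel σ ρ) reord
      (Rotation.rotation-paved (relabel σ ρ) reord (In3-rotate ∘ In3-rotate) eca eab ebc consτ out-paved c-clear b-clear)
      where
      reord : ReorderOf σ (relabel σ ρ) a b c
      reord = relabel-reorders ρ cycle-fix cycle-In3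
      consτ : Consecutive (relabel σ ρ) c a b
      consτ = consecutive-cong {σ = σ} (sym cycle-w) (sym cycle-u) (sym cycle-v) cons

    rotate-bca : ¬ ∃ (OutLeft a) × ¬ ∃ (OutRight b) → Repaved
    rotate-bca (a-clear , b-clear) = repaved (relabel σ ρ²) reord
      (Rotation.rotation-paved (relabel σ ρ²) reord In3-rotate ebc eca eab consτ out-paved b-clear a-clear)
      where
      reord : ReorderOf σ (relabel σ ρ²) a b c
      reord = relabel-reorders ρ² (λ x∉ → trans (cong (ρ ⟨$⟩ʳ_) (cycle-fix x∉)) (cycle-fix x∉)) (cycle-In3 ∘ cycle-In3)
      consτ : Consecutive (relabel σ ρ²) b c a
      consτ = consecutive-cong {σ = σ}
        (sym (trans (cong (ρ ⟨$⟩ʳ_) cycle-v) cycle-w))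
        (sym (trans (cong (ρ ⟨$⟩ʳ_) cycle-w) cycle-u))
        (sym (trans (cong (ρ ⟨$⟩ʳ_) cycle-u) cycle-v))
        cons

    repave-or-subdivide : ¬ Contains T Δ122 →
      NoCommonNbr (B T σ) a b → NoCommonNbr (B T σ) b c → NoCommonNbr (B T σ) a c →
      Contains T P7⁻ ⊎ Repaved
    repave-or-subdivide no-Δ nab nbc nac
      with arc-clear-or-subdivided c∈ a∈ (λ x → nac x ∘ swap)
         | arc-clear-or-subdivided a∈ b∈ nab
         | arc-clear-or-subdivided b∈ c∈ nbc
    ... | inj₁ clear | _ | _ = inj₂ (rotate-abc clear)
    ... | inj₂ _ | inj₁ clear | _ = inj₂ (rotate-bca clear)
    ... | inj₂ _ | inj₂ _ | inj₁ clear = inj₂ (rotate-cab clear)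
    ... | inj₂ (x , ecx , exa) | inj₂ (y , eay , eyb) | inj₂ (z , ebz , ezc) =
      [ ⊥-elim ∘ no-Δ , inj₁ ]′ (subdivided-triangle T eab ebc eca ecx exa eay eyb ebz ezc)

lemma4p4 : ∀ {n} (Tn : Tournament n) (σ : Ordering n) (a b c : Fin n) →
    ¬ Contains Tn Δ122 →
    a ≢ b → b ≢ c → a ≢ c →
    CyclicTriangle Tn a b c →
    Consecutive σ a b c →
    Paved σ (deleteEdge (B Tn σ) a c) a →
    Paved σ (deleteEdge (B Tn σ) a c) b →
    Paved σ (deleteEdge (B Tn σ) a c) c →
    NoCommonNbr (B Tn σ) a b → NoCommonNbr (B Tn σ) b c → NoCommonNbr (B Tn σ) a c →
    Contains Tn T5 ⊎ (Contains Tn P7⁻ ⊎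
      Σ (Ordering n) λ σ' → ReorderOf σ σ' a b c ×
        (Paved σ' (B Tn σ') a × Paved σ' (B Tn σ') b × Paved σ' (B Tn σ') c))
lemma4p4 T σ a b c _ _ _ _ (inj₂ (_ , ecb , eba)) cons _ _ _ _ _ nac =
  ⊥-elim (nac b (inj₂ (successor-before σ (proj₁ cons) , eba) , inj₁ (successor-before σ (proj₂ cons) , ecb)))
lemma4p4 T σ a b c no-Δ a≢b b≢c a≢c (inj₁ (eab , ebc , eca)) cons pva pvb pvc nab nbc nac =
  inj₂ (repave-or-subdivide no-Δ nab nbc nac)
  where
  open Block T σ cons
  out-paved : ∀ {s} → Inside s → AtMostOne (OutLeft s) × AtMostOne (OutRight s)
  out-paved (inj₁ refl) = outside-paved pva
  out-paved (inj₂ (inj₁ refl)) = outside-paved pvb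
  out-paved (inj₂ (inj₂ refl)) = outside-paved pvc
  open Rotations a≢b b≢c a≢c eab ebc eca out-paved
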